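{- Let $\Sigma\subseteq\{\veebar,\wedge,\vee,\mathbin{\barwedge},\mathbin{\dot\vee},\mathbin{\dot\barwedge}\}$, let $\mathbb{A}_0,\mathbb{B}_0$ be sets of $\Phi$-teams and $k_0\in\mathbb{N}$. Then S has a winning strategy in the game $\mathrm{FS}^\Sigma_{k_0}(\mathbb{A}_0,\mathbb{B}_0)$ if and only if there is a formula $\varphi\in\mathrm{PL}(\Sigma)$ with $\mathrm{wd}(\varphi)\leq k_0$ which separates $\mathbb{A}_0$ from $\mathbb{B}_0$.
   Context: A domain $\Phi$ is a finite set of propositional variables; a $\Phi$-team is a set of maps $\Phi\to\{0,1\}$. A split of $T$ is $(T_1,T_2)$ with $T_1,T_2\subseteq T$, $T_1\cup T_2=T$; strict if $T_1\cap T_2=\emptyset$; $\mathrm{Sp}(T)$ and $\mathrm{SSp}(T)$ denote the sets of splits and strict splits. $\Phi$-literals: $\top,\bot,{\sim}\top,{\sim}\bot,p,\neg p,{\sim}p,{\sim}\neg p$ ($p\in\Phi$); $\mathrm{PL}(\Sigma)$ is the set of formulas built from $\Phi$-literals using connectives in $\Sigma$. Semantics: $T\models\top$ always; $T\models\bot$ iff $T=\emptyset$; $T\models p$ iff $s(p)=1$ for all $s\in T$; $T\models\neg p$ iff $s(p)=0$ for all $s\in T$; $T\models{\sim}\ell$ iff $T\not\models\ell$; $\wedge$ conjunction; $T\models\psi\veebar\theta$ iff $T\models\psi$ or $T\models\theta$; $T\models\psi\vee\theta$ iff some $(S,U)\in\mathrm{Sp}(T)$ has $S\models\psi$ and $U\models\theta$;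 $T\models\psi\mathbin{\barwedge}\theta$ iff every $(S,U)\in\mathrm{Sp}(T)$ has $S\models\psi$ or $U\models\theta$; $\mathbin{\dot\vee}$ and $\mathbin{\dot\barwedge}$ are the same with $\mathrm{SSp}(T)$. Width: $\mathrm{wd}(\ell)=1$ for literals, $\mathrm{wd}(\psi\circ\theta)=\mathrm{wd}(\psi)+\mathrm{wd}(\theta)$. A formula $\varphi$ separates $\mathbb{A}$ from $\mathbb{B}$ if $A\models\varphi$ for all $A\in\mathbb{A}$ and $B\not\models\varphi$ for all $B\in\mathbb{B}$. The game $\mathrm{FS}^\Sigma_{k_0}(\mathbb{A}_0,\mathbb{B}_0)$ between players S and D has positions $(k,\mathbb{A},\mathbb{B})$ ($k\in\mathbb{N}$, $\mathbb{A},\mathbb{B}$ sets of $\Phi$-teams), starting at $(k_0,\mathbb{A}_0,\mathbb{B}_0)$. If $k_0=0$, D wins. In a position with $k\geq1$, S makes one of the following moves (a connective move only for connectives in $\Sigma$); in each connective move S also chooses $k_1,k_2>0$ with $k_1+k_2=k$, then D chooses $i\in\{1,2\}$ and play continues from the indicated position. $\veebar$-move: S chooses $\mathbb{A}_1,\mathbb{A}_2\subseteq\mathbb{A}$ with $\mathbb{A}_1\cup\mathbb{A}_2=\mathbb{A}$; next position $(k_i,\mathbb{A}_i,\mathbb{B})$. $\wedge$-move: S chooses $\mathbb{B}_1,\mathbb{B}_2\subseteq\mathbb{B}$ with union $\mathbb{B}$; next $(k_i,\mathbb{A},\mathbb{B}_i)$. $\vee$-move: for each $A\in\mathbb{A}$,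 S chooses a split $(A_1,A_2)\in\mathrm{Sp}(A)$, and for each $B\in\mathbb{B}$ a function $f_B:\mathrm{Sp}(B)\to\{1,2\}$; let $\mathbb{A}_i=\{A_i:A\in\mathbb{A}\}$ and $\mathbb{B}_i=\{B_i: B\in\mathbb{B},(B_1,B_2)\in\mathrm{Sp}(B),f_B(B_1,B_2)=i\}$; next $(k_i,\mathbb{A}_i,\mathbb{B}_i)$. $\mathbin{\barwedge}$-move: as the $\vee$-move with the roles of $\mathbb{A}$ and $\mathbb{B}$ swapped. $\mathbin{\dot\vee}$-move and $\mathbin{\dot\barwedge}$-move: as the $\vee$- and $\mathbin{\barwedge}$-moves but with only strict splits. Literal move: S chooses a $\Phi$-literal $\ell$; S wins if $\ell$ separates $\mathbb{A}$ from $\mathbb{B}$, otherwise D wins. -}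

module Defs where

open import Level using (0ℓ)
open import Data.Bool using (Bool; true; false; T; if_then_else_; _∨_; _∧_)
open import Data.Nat using (ℕ; zero; suc; _+_; _<_)
open import Data.Fin using (Fin)
open import Data.Vec using (Vec; []; _∷_; lookup)
open import Data.Product using (Σ; _×_; _,_)
open import Data.Sum using (_⊎_)
open import Data.Unit using (⊤)
open import Relation.Nullary using (¬_)
open import Relation.Unary using (Pred; _⊆_; _∪_)
open import Relation.Binary.PropositionalEquality using (_≡_)

-- Domain Φ = Fin n (a finite set of n propositional variables).
-- An assignment s : Φ → {0,1} is a vector Vec Bool n, s(p) = lookup s p.
-- A Φ-team (a set of assignments) is represented canonically as a
-- binary trie: its characteristic function on the 2^n assignments.

Team : ℕ → Set
Team zero = Bool
Team (suc n) = Team n × Team n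

_∈ₜ_ : ∀ {n} → Vec Bool n → Team n → Set
_∈ₜ_ {zero} [] b = T b
_∈ₜ_ {suc n} (x ∷ s) (t₀ , t₁) = s ∈ₜ (if x then t₁ else t₀)

∅ₜ : ∀ {n} → Team n
∅ₜ {zero} = false
∅ₜ {suc n} = ∅ₜ , ∅ₜ

_∪ₜ_ : ∀ {n} → Team n → Team n → Team n
_∪ₜ_ {zero} a b = a ∨ b
_∪ₜ_ {suc n} (a₀ , a₁) (b₀ , b₁) = (a₀ ∪ₜ b₀) , (a₁ ∪ₜ b₁)

_∩ₜ_ : ∀ {n} → Team n → Team n → Team n
_∩ₜ_ {zero} a b = a ∧ b
_∩ₜ_ {suc n} (a₀ , a₁) (b₀ , b₁) = (a₀ ∩ₜ b₀) , (a₁ ∩ₜ b₁)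

-- Splits. strict = false : Sp(T);  strict = true : SSp(T).
record Split {n} (strict : Bool) (Tm : Team n) : Set where
  constructor split
  field
    left  : Team n
    right : Team n
    cover : left ∪ₜ right ≡ Tm
    disj  : if strict then left ∩ₜ right ≡ ∅ₜ else ⊤
open Split public

data Side : Set where
  ₁ ₂ : Side

part : ∀ {n st} {Tm : Team n} → Side → Split st Tm → Team n
part ₁ sp = left sp
part ₂ sp = right sp

data Atom (n : ℕ) : Set where
  ⊤ᵃ ⊥ᵃ : Atom n
  posᵃ negᵃ : Fin n → Atom n

-- Φ-literals: atoms α and their Boolean negations ∼α
data Lit (n : ℕ) : Set where
  plain : Atom n → Lit n
  tilde : Atom n → Lit n

-- connectives: ⊻ (Boolean disjunction), ∧, ∨ (split disjunction),
-- ⊼ (barwedge), ∨̇ (strict split disjunction), ⊼̇ (strict barwedge)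
data Conn : Set where
  c⊻ c∧ c∨ c⊼ c∨̇ c⊼̇ : Conn

data Formula (n : ℕ) : Set where
  lit : Lit n → Formula n
  bin : Conn → Formula n → Formula n → Formula n

Connectives : Set
Connectives = Conn → Bool

InPL : ∀ {n} → Connectives → Formula n → Set
InPL Cs (lit ℓ) = ⊤
InPL Cs (bin c φ ψ) = T (Cs c) × InPL Cs φ × InPL Cs ψ

wd : ∀ {n} → Formula n → ℕ
wd (lit ℓ) = 1
wd (bin c φ ψ) = wd φ + wd ψ

_⊨ᵃ_ : ∀ {n} → Team n → Atom n → Set
Tm ⊨ᵃ ⊤ᵃ = ⊤
Tm ⊨ᵃ ⊥ᵃ = Tm ≡ ∅ₜ
Tm ⊨ᵃ posᵃ p = ∀ s → s ∈ₜ Tm → lookup s p ≡ true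
Tm ⊨ᵃ negᵃ p = ∀ s → s ∈ₜ Tm → lookup s p ≡ false

_⊨ˡ_ : ∀ {n} → Team n → Lit n → Set
Tm ⊨ˡ plain α = Tm ⊨ᵃ α
Tm ⊨ˡ tilde α = ¬ (Tm ⊨ᵃ α)

_⊨_ : ∀ {n} → Team n → Formula n → Set
Tm ⊨ lit ℓ = Tm ⊨ˡ ℓ
Tm ⊨ bin c⊻ φ ψ = (Tm ⊨ φ) ⊎ (Tm ⊨ ψ)
Tm ⊨ bin c∧ φ ψ = (Tm ⊨ φ) × (Tm ⊨ ψ)
Tm ⊨ bin c∨ φ ψ = Σ (Split false Tm) λ sp → (left sp ⊨ φ) × (right sp ⊨ ψ)
Tm ⊨ bin c⊼ φ ψ = (sp : Split false Tm) → (left sp ⊨ φ) ⊎ (right sp ⊨ ψ)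
Tm ⊨ bin c∨̇ φ ψ = Σ (Split true Tm) λ sp → (left sp ⊨ φ) × (right sp ⊨ ψ)
Tm ⊨ bin c⊼̇ φ ψ = (sp : Split true Tm) → (left sp ⊨ φ) ⊎ (right sp ⊨ ψ)

TeamSet : ℕ → Set₁
TeamSet n = Pred (Team n) 0ℓ

Separates : ∀ {n} → Formula n → TeamSet n → TeamSet n → Set
Separates φ 𝔸 𝔹 = (∀ A → A ∈' 𝔸 → A ⊨ φ) × (∀ B → B ∈' 𝔹 → ¬ (B ⊨ φ))
  where
  _∈'_ : ∀ {n} → Team n → TeamSet n → Set
  X ∈' 𝕏 = 𝕏 X

Chosen : ∀ {n st} → Side → TeamSet n → ((X : Team n) → Split st X) → TeamSet n
Chosen i 𝕏 c Y = Σ _ λ X → 𝕏 X × part i (c X) ≡ Y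

Fiber : ∀ {n st} → Side → TeamSet n → ((Y : Team n) → Split st Y → Side) → TeamSet n
Fiber i 𝕐 f Z = Σ _ λ Y → 𝕐 Y × Σ (Split _ Y) λ sp → f Y sp ≡ i × part i sp ≡ Z

orConn : Bool → Conn
orConn false = c∨
orConn true = c∨̇

barConn : Bool → Conn
barConn false = c⊼
barConn true = c⊼̇

-- SWins Cs k 𝔸 𝔹 : player S has a winning strategy from position (k,𝔸,𝔹).
-- (The game is finite, so this inductive definition captures winning
-- strategies exactly.)  No constructor for k = 0: then D wins.
data SWins {n} (Cs : Connectives) : ℕ → TeamSet n → TeamSet n → Set₁ where
  litMove : ∀ {k 𝔸 𝔹} (ℓ : Lit n) → Separates (lit ℓ) 𝔸 𝔹 → SWins Cs (suc k) 𝔸 𝔹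
  ⊻Move : ∀ {k 𝔸 𝔹} → T (Cs c⊻) → (k₁ k₂ : ℕ) → 0 < k₁ → 0 < k₂ → k₁ + k₂ ≡ k →
    (𝔸₁ 𝔸₂ : TeamSet n) → 𝔸₁ ⊆ 𝔸 → 𝔸₂ ⊆ 𝔸 → 𝔸 ⊆ 𝔸₁ ∪ 𝔸₂ →
    SWins Cs k₁ 𝔸₁ 𝔹 → SWins Cs k₂ 𝔸₂ 𝔹 → SWins Cs k 𝔸 𝔹
  ∧Move : ∀ {k 𝔸 𝔹} → T (Cs c∧) → (k₁ k₂ : ℕ) → 0 < k₁ → 0 < k₂ → k₁ + k₂ ≡ k →
    (𝔹₁ 𝔹₂ : TeamSet n) → 𝔹₁ ⊆ 𝔹 → 𝔹₂ ⊆ 𝔹 → 𝔹 ⊆ 𝔹₁ ∪ 𝔹₂ →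
    SWins Cs k₁ 𝔸 𝔹₁ → SWins Cs k₂ 𝔸 𝔹₂ → SWins Cs k 𝔸 𝔹
  ∨Move : ∀ {k 𝔸 𝔹} (strict : Bool) → T (Cs (orConn strict)) →
    (k₁ k₂ : ℕ) → 0 < k₁ → 0 < k₂ → k₁ + k₂ ≡ k →
    (c : (A : Team n) → Split strict A) → (f : (B : Team n) → Split strict B → Side) →
    SWins Cs k₁ (Chosen ₁ 𝔸 c) (Fiber ₁ 𝔹 f) →
    SWins Cs k₂ (Chosen ₂ 𝔸 c) (Fiber ₂ 𝔹 f) → SWins Cs k 𝔸 𝔹
  ⊼Move : ∀ {k 𝔸 𝔹} (strict : Bool) → T (Cs (barConn strict)) →
    (k₁ k₂ : ℕ) → 0 < k₁ → 0 < k₂ → k₁ + k₂ ≡ k →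
    (c : (B : Team n) → Split strict B) → (f : (A : Team n) → Split strict A → Side) →
    SWins Cs k₁ (Fiber ₁ 𝔸 f) (Chosen ₁ 𝔹 c) →
    SWins Cs k₂ (Fiber ₂ 𝔸 f) (Chosen ₂ 𝔹 c) → SWins Cs k 𝔸 𝔹

-- A winning strategy is a formula in disguise: each connective move becomes
-- the corresponding connective, a literal move its literal, and the budget is
-- split exactly as the width is.  Conversely S plays a separating formula
-- top-down with budget exactly its width (extra budget never hurts): for ∨ she
-- splits each team of 𝔸 along a split witnessing its truth and sends a split of
-- a team of 𝔹 to a side whose disjunct fails there (dually for ⊼).  Choosing
-- these splits needs satisfaction to be decidable, which it is because teams,
-- assignments and splits range over finite sets.
module Submission where

open import Defs
open import Data.Nat using (ℕ; _≤_)
open import Data.Product using (Σ; _×_)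
open import Function.Bundles using (_⇔_)

open import Level using (0ℓ)
open import Axiom.UniquenessOfIdentityProofs using (module Decidable⇒UIP)
open import Data.Bool using (Bool; true; false; T; T?; if_then_else_)
import Data.Bool.Properties as Bool
open import Data.Nat using (zero; suc; _+_; _<_; z≤n; s≤s)
open import Data.Nat.Properties using (≤-trans; m≤m+n; +-assoc; +-mono-≤; m≤n⇒∃[o]m+o≡n)
open import Data.Product using (_,_; proj₁; proj₂)
open import Data.Product.Properties using (≡-dec)
open import Data.Sum using (_⊎_; inj₁; inj₂; [_,_])
import Data.Sum as Sum
open import Data.Unit using (⊤; tt)
open import Data.Empty using (⊥-elim)
open import Data.Vec using (Vec; []; _∷_; lookup)
open import Function using (_∘_; id)
open import Function.Bundles using (mk⇔; Equivalence)
open import Relation.Binary.Definitions using (DecidableEquality)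
open import Relation.Binary.PropositionalEquality using (_≡_; refl; sym; cong₂; subst)
open import Relation.Nullary using (¬_; Dec; yes; no; Irrelevant)
open import Relation.Nullary.Decidable
  using (map′; ¬?; _×-dec_; _⊎-dec_; _→-dec_; decidable-stable; toSum)
open import Relation.Unary using (Pred; Decidable; _⊆_; _∪_; _∩_; ∁)

open Equivalence using (to; from)

private
  variable
    n k : ℕ
    st : Bool
    Cs : Connectives

Searchable : Set → Set₁
Searchable A = ∀ {P : Pred A 0ℓ} → Decidable P → Dec (Σ A P)

module _ {A : Set} where

  ¬∃¬⇒∀ : {P : Pred A 0ℓ} → Decidable P → ¬ Σ A (∁ P) → ∀ x → P x
  ¬∃¬⇒∀ P? ∄¬P x = decidable-stable (P? x) (λ ¬Px → ∄¬P (x , ¬Px))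

  ∀? : Searchable A → {P : Pred A 0ℓ} → Decidable P → Dec (∀ x → P x)
  ∀? search P? = map′ (¬∃¬⇒∀ P?) (λ ∀P (x , ¬Px) → ¬Px (∀P x)) (¬? (search (¬? ∘ P?)))

  ¬∀⇒∃¬ : Searchable A → {P : Pred A 0ℓ} → Decidable P → ¬ (∀ x → P x) → Σ A (∁ P)
  ¬∀⇒∃¬ search P? ¬∀P = decidable-stable (search (¬? ∘ P?)) (¬∀P ∘ ¬∃¬⇒∀ P?)

  choice : {P : Pred A 0ℓ} → A → Dec (Σ A P) → A
  choice _ (yes (x , _)) = x
  choice x₀ (no _) = x₀

  choice-sat : {P : Pred A 0ℓ} {x₀ : A} (d : Dec (Σ A P)) → Σ A P → P (choice x₀ d)
  choice-sat (yes (_ , Px)) _ = Px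
  choice-sat (no ∄P) ∃P = ⊥-elim (∄P ∃P)

search-Bool : Searchable Bool
search-Bool P? =
  map′ [ (true ,_) , (false ,_) ] (λ { (true , p) → inj₁ p ; (false , p) → inj₂ p })
    (P? true ⊎-dec P? false)

search-× : {A B : Set} → Searchable A → Searchable B → Searchable (A × B)
search-× search-A search-B P? =
  map′ (λ (a , b , p) → (a , b) , p) (λ ((a , b) , p) → a , b , p)
    (search-A λ a → search-B λ b → P? (a , b))

search-Σ : {A : Set} {Q : Pred A 0ℓ} → Searchable A → Decidable Q → (∀ {x} → Irrelevant (Q x)) →
  Searchable (Σ A Q)
search-Σ {A} {Q} search-A Q? Q-irr {P} P? =
  map′ (λ (a , q , p) → (a , q) , p) (λ ((a , q) , p) → a , q , p) (search-A fibre?)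
  where
  fibre? : ∀ a → Dec (Σ (Q a) λ q → P (a , q))
  fibre? a with Q? a
  ... | yes q = map′ (q ,_) (λ (q′ , p) → subst (λ q → P (a , q)) (Q-irr q′ q) p) (P? (a , q))
  ... | no ¬q = no (¬q ∘ proj₁)

search-Vec : Searchable (Vec Bool n)
search-Vec {zero} P? = map′ ([] ,_) (λ { ([] , p) → p }) (P? [])
search-Vec {suc n} P? =
  map′ (λ ((b , v) , p) → b ∷ v , p) (λ { (b ∷ v , p) → (b , v) , p })
    (search-× search-Bool search-Vec λ (b , v) → P? (b ∷ v))

search-Team : Searchable (Team n)
search-Team {zero} = search-Bool
search-Team {suc n} = search-× search-Team search-Team

_≟ₜ_ : DecidableEquality (Team n)
_≟ₜ_ {zero} = Bool._≟_
_≟ₜ_ {suc n} = ≡-dec _≟ₜ_ _≟ₜ_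

_∈ₜ?_ : (s : Vec Bool n) (X : Team n) → Dec (s ∈ₜ X)
_∈ₜ?_ {zero} [] b = T? b
_∈ₜ?_ {suc n} (x ∷ s) (X₀ , X₁) = s ∈ₜ? (if x then X₁ else X₀)

∪ₜ-identityʳ : (X : Team n) → X ∪ₜ ∅ₜ ≡ X
∪ₜ-identityʳ {zero} = Bool.∨-identityʳ
∪ₜ-identityʳ {suc n} (X₀ , X₁) = cong₂ _,_ (∪ₜ-identityʳ X₀) (∪ₜ-identityʳ X₁)

∩ₜ-zeroʳ : (X : Team n) → X ∩ₜ ∅ₜ ≡ ∅ₜ
∩ₜ-zeroʳ {zero} = Bool.∧-zeroʳ
∩ₜ-zeroʳ {suc n} (X₀ , X₁) = cong₂ _,_ (∩ₜ-zeroʳ X₀) (∩ₜ-zeroʳ X₁)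

module _ {n : ℕ} where

  private
    variable
      φ ψ : Formula n
      𝔸 𝔹 : TeamSet n

  Disjoint : Bool → Team n → Team n → Set
  Disjoint strict L R = if strict then L ∩ₜ R ≡ ∅ₜ else ⊤

  disjoint? : ∀ strict (L R : Team n) → Dec (Disjoint strict L R)
  disjoint? true L R = (L ∩ₜ R) ≟ₜ ∅ₜ
  disjoint? false L R = yes tt

  disjoint-irrelevant : ∀ strict {L R : Team n} → Irrelevant (Disjoint strict L R)
  disjoint-irrelevant true = Decidable⇒UIP.≡-irrelevant _≟ₜ_
  disjoint-irrelevant false _ _ = refl

  trivialSplit : ∀ strict (X : Team n) → Split strict X
  trivialSplit false X = split X ∅ₜ (∪ₜ-identityʳ X) tt
  trivialSplit true X = split X ∅ₜ (∪ₜ-identityʳ X) (∩ₜ-zeroʳ X)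

  search-Split : {X : Team n} → Searchable (Split st X)
  search-Split {st} {X} P? =
    map′ (λ ((((L , R) , c) , d) , p) → split L R c d , p)
         (λ (split L R c d , p) → (((L , R) , c) , d) , p)
         (search-Σ search-Cover (λ ((L , R) , _) → disjoint? st L R) (disjoint-irrelevant st)
           λ (((L , R) , c) , d) → P? (split L R c d))
    where
    covers? : Decidable {A = Team n × Team n} λ (L , R) → L ∪ₜ R ≡ X
    covers? (L , R) = (L ∪ₜ R) ≟ₜ X
    search-Cover : Searchable (Σ (Team n × Team n) λ (L , R) → L ∪ₜ R ≡ X)
    search-Cover =
      search-Σ (search-× search-Team search-Team) covers? (Decidable⇒UIP.≡-irrelevant _≟ₜ_)

  _⊨ᵃ?_ : (X : Team n) (α : Atom n) → Dec (X ⊨ᵃ α)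
  X ⊨ᵃ? ⊤ᵃ = yes tt
  X ⊨ᵃ? ⊥ᵃ = X ≟ₜ ∅ₜ
  X ⊨ᵃ? posᵃ p = ∀? search-Vec λ s → s ∈ₜ? X →-dec lookup s p Bool.≟ true
  X ⊨ᵃ? negᵃ p = ∀? search-Vec λ s → s ∈ₜ? X →-dec lookup s p Bool.≟ false

  _⊨?_ : (X : Team n) (φ : Formula n) → Dec (X ⊨ φ)
  X ⊨? lit (plain α) = X ⊨ᵃ? α
  X ⊨? lit (tilde α) = ¬? (X ⊨ᵃ? α)
  X ⊨? bin c⊻ φ ψ = X ⊨? φ ⊎-dec X ⊨? ψ
  X ⊨? bin c∧ φ ψ = X ⊨? φ ×-dec X ⊨? ψ
  X ⊨? bin c∨ φ ψ = search-Split λ sp → left sp ⊨? φ ×-dec right sp ⊨? ψ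
  X ⊨? bin c⊼ φ ψ = ∀? search-Split λ sp → left sp ⊨? φ ⊎-dec right sp ⊨? ψ
  X ⊨? bin c∨̇ φ ψ = search-Split λ sp → left sp ⊨? φ ×-dec right sp ⊨? ψ
  X ⊨? bin c⊼̇ φ ψ = ∀? search-Split λ sp → left sp ⊨? φ ⊎-dec right sp ⊨? ψ

  Sat : Formula n → TeamSet n
  Sat φ X = X ⊨ φ

  SomeSplit EverySplit : Bool → Team n → Formula n → Formula n → Set
  SomeSplit strict X φ ψ = Σ (Split strict X) λ sp → left sp ⊨ φ × right sp ⊨ ψ
  EverySplit strict X φ ψ = (sp : Split strict X) → left sp ⊨ φ ⊎ right sp ⊨ ψ

  ⊨orConn⇔ : ∀ strict {X : Team n} → X ⊨ bin (orConn strict) φ ψ ⇔ SomeSplit strict X φ ψ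
  ⊨orConn⇔ false = mk⇔ id id
  ⊨orConn⇔ true = mk⇔ id id

  ⊨barConn⇔ : ∀ strict {X : Team n} → X ⊨ bin (barConn strict) φ ψ ⇔ EverySplit strict X φ ψ
  ⊨barConn⇔ false = mk⇔ id id
  ⊨barConn⇔ true = mk⇔ id id

  Separable : Connectives → ℕ → TeamSet n → TeamSet n → Set
  Separable Cs k 𝔸 𝔹 = Σ (Formula n) λ φ → InPL Cs φ × wd φ ≤ k × Separates φ 𝔸 𝔹

  ⊻-separates : ∀ {𝔸₁ 𝔸₂} → 𝔸 ⊆ 𝔸₁ ∪ 𝔸₂ → ∀ φ ψ →
    Separates φ 𝔸₁ 𝔹 → Separates ψ 𝔸₂ 𝔹 → Separates (bin c⊻ φ ψ) 𝔸 𝔹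
  ⊻-separates 𝔸⊆ _ _ (A⊨φ , B⊭φ) (A⊨ψ , B⊭ψ) =
    (λ A a → Sum.map (A⊨φ A) (A⊨ψ A) (𝔸⊆ a)) , λ B b → [ B⊭φ B b , B⊭ψ B b ]

  ∧-separates : ∀ {𝔹₁ 𝔹₂} → 𝔹 ⊆ 𝔹₁ ∪ 𝔹₂ → ∀ φ ψ →
    Separates φ 𝔸 𝔹₁ → Separates ψ 𝔸 𝔹₂ → Separates (bin c∧ φ ψ) 𝔸 𝔹
  ∧-separates 𝔹⊆ _ _ (A⊨φ , B⊭φ) (A⊨ψ , B⊭ψ) =
    (λ A a → A⊨φ A a , A⊨ψ A a) ,
    λ B b (B⊨φ , B⊨ψ) → [ (λ b₁ → B⊭φ B b₁ B⊨φ) , (λ b₂ → B⊭ψ B b₂ B⊨ψ) ] (𝔹⊆ b)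

  ∨-separates : ∀ strict (c : (A : Team n) → Split strict A)
    (f : (B : Team n) → Split strict B → Side) → ∀ φ ψ →
    Separates φ (Chosen ₁ 𝔸 c) (Fiber ₁ 𝔹 f) → Separates ψ (Chosen ₂ 𝔸 c) (Fiber ₂ 𝔹 f) →
    Separates (bin (orConn strict) φ ψ) 𝔸 𝔹
  ∨-separates {𝔸} {𝔹} strict c f φ ψ (A⊨φ , B⊭φ) (A⊨ψ , B⊭ψ) =
    (λ A a → from (⊨orConn⇔ strict) (c A , A⊨φ _ (A , a , refl) , A⊨ψ _ (A , a , refl))) ,
    λ B b → refute B b ∘ to (⊨orConn⇔ strict)
    where
    refute : ∀ B → 𝔹 B → ¬ SomeSplit strict B φ ψ
    refute B b (sp , L⊨φ , R⊨ψ) with f B sp in side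
    ... | ₁ = B⊭φ _ (B , b , sp , side , refl) L⊨φ
    ... | ₂ = B⊭ψ _ (B , b , sp , side , refl) R⊨ψ

  ⊼-separates : ∀ strict (c : (B : Team n) → Split strict B)
    (f : (A : Team n) → Split strict A → Side) → ∀ φ ψ →
    Separates φ (Fiber ₁ 𝔸 f) (Chosen ₁ 𝔹 c) → Separates ψ (Fiber ₂ 𝔸 f) (Chosen ₂ 𝔹 c) →
    Separates (bin (barConn strict) φ ψ) 𝔸 𝔹
  ⊼-separates {𝔸} {𝔹} strict c f φ ψ (A⊨φ , B⊭φ) (A⊨ψ , B⊭ψ) =
    (λ A a → from (⊨barConn⇔ strict) (satisfy A a)) ,
    λ B b B⊨ → [ B⊭φ _ (B , b , refl) , B⊭ψ _ (B , b , refl) ] (to (⊨barConn⇔ strict) B⊨ (c B))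
    where
    satisfy : ∀ A → 𝔸 A → EverySplit strict A φ ψ
    satisfy A a sp with f A sp in side
    ... | ₁ = inj₁ (A⊨φ _ (A , a , sp , side , refl))
    ... | ₂ = inj₂ (A⊨ψ _ (A , a , sp , side , refl))

  bin-separable : ∀ {c k₁ k₂ 𝔸₁ 𝔹₁ 𝔸₂ 𝔹₂} → T (Cs c) → k₁ + k₂ ≡ k →
    Separable Cs k₁ 𝔸₁ 𝔹₁ → Separable Cs k₂ 𝔸₂ 𝔹₂ →
    (∀ φ ψ → Separates φ 𝔸₁ 𝔹₁ → Separates ψ 𝔸₂ 𝔹₂ → Separates (bin c φ ψ) 𝔸 𝔹) →
    Separable Cs k 𝔸 𝔹
  bin-separable c∈ refl (φ , φ∈ , wdφ≤ , φ-sep) (ψ , ψ∈ , wdψ≤ , ψ-sep) sep =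
    bin _ φ ψ , (c∈ , φ∈ , ψ∈) , +-mono-≤ wdφ≤ wdψ≤ , sep φ ψ φ-sep ψ-sep

  wins⇒separable : SWins Cs k 𝔸 𝔹 → Separable Cs k 𝔸 𝔹
  wins⇒separable (litMove ℓ sep) = lit ℓ , tt , s≤s z≤n , sep
  wins⇒separable (⊻Move c∈ _ _ _ _ k≡ _ _ _ _ 𝔸⊆ w₁ w₂) =
    bin-separable c∈ k≡ (wins⇒separable w₁) (wins⇒separable w₂) (⊻-separates 𝔸⊆)
  wins⇒separable (∧Move c∈ _ _ _ _ k≡ _ _ _ _ 𝔹⊆ w₁ w₂) =
    bin-separable c∈ k≡ (wins⇒separable w₁) (wins⇒separable w₂) (∧-separates 𝔹⊆)
  wins⇒separable (∨Move strict c∈ _ _ _ _ k≡ c f w₁ w₂) =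
    bin-separable c∈ k≡ (wins⇒separable w₁) (wins⇒separable w₂) (∨-separates strict c f)
  wins⇒separable (⊼Move strict c∈ _ _ _ _ k≡ c f w₁ w₂) =
    bin-separable c∈ k≡ (wins⇒separable w₁) (wins⇒separable w₂) (⊼-separates strict c f)

  SWins-+ : ∀ d → SWins Cs k 𝔸 𝔹 → SWins Cs (k + d) 𝔸 𝔹
  SWins-+ d (litMove ℓ sep) = litMove ℓ sep
  SWins-+ d (⊻Move c∈ k₁ k₂ k₁>0 k₂>0 refl 𝔸₁ 𝔸₂ ⊆₁ ⊆₂ 𝔸⊆ w₁ w₂) =
    ⊻Move c∈ k₁ (k₂ + d) k₁>0 (≤-trans k₂>0 (m≤m+n k₂ d)) (sym (+-assoc k₁ k₂ d))
      𝔸₁ 𝔸₂ ⊆₁ ⊆₂ 𝔸⊆ w₁ (SWins-+ d w₂)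
  SWins-+ d (∧Move c∈ k₁ k₂ k₁>0 k₂>0 refl 𝔹₁ 𝔹₂ ⊆₁ ⊆₂ 𝔹⊆ w₁ w₂) =
    ∧Move c∈ k₁ (k₂ + d) k₁>0 (≤-trans k₂>0 (m≤m+n k₂ d)) (sym (+-assoc k₁ k₂ d))
      𝔹₁ 𝔹₂ ⊆₁ ⊆₂ 𝔹⊆ w₁ (SWins-+ d w₂)
  SWins-+ d (∨Move strict c∈ k₁ k₂ k₁>0 k₂>0 refl c f w₁ w₂) =
    ∨Move strict c∈ k₁ (k₂ + d) k₁>0 (≤-trans k₂>0 (m≤m+n k₂ d)) (sym (+-assoc k₁ k₂ d))
      c f w₁ (SWins-+ d w₂)
  SWins-+ d (⊼Move strict c∈ k₁ k₂ k₁>0 k₂>0 refl c f w₁ w₂) =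
    ⊼Move strict c∈ k₁ (k₂ + d) k₁>0 (≤-trans k₂>0 (m≤m+n k₂ d)) (sym (+-assoc k₁ k₂ d))
      c f w₁ (SWins-+ d w₂)

  SWins-mono : ∀ {k k′} → k ≤ k′ → SWins Cs k 𝔸 𝔹 → SWins Cs k′ 𝔸 𝔹
  SWins-mono k≤k′ w with m≤n⇒∃[o]m+o≡n k≤k′
  ... | d , refl = SWins-+ d w

  wd>0 : (φ : Formula n) → 0 < wd φ
  wd>0 (lit ℓ) = s≤s z≤n
  wd>0 (bin c φ ψ) = ≤-trans (wd>0 φ) (m≤m+n (wd φ) (wd ψ))

  side : {P : Set} → Dec P → Side
  side (yes _) = ₁
  side (no _) = ₂

  side≡₁ : {P : Set} (d : Dec P) → side d ≡ ₁ → P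
  side≡₁ (yes p) _ = p

  side≡₂ : {P : Set} (d : Dec P) → side d ≡ ₂ → ¬ P
  side≡₂ (no ¬p) _ = ¬p

  module BinaryWins (φ ψ : Formula n)
    (φ-wins : ∀ {𝔸 𝔹} → Separates φ 𝔸 𝔹 → SWins Cs (wd φ) 𝔸 𝔹)
    (ψ-wins : ∀ {𝔸 𝔹} → Separates ψ 𝔸 𝔹 → SWins Cs (wd ψ) 𝔸 𝔹) where

    ⊻-wins : T (Cs c⊻) → Separates (bin c⊻ φ ψ) 𝔸 𝔹 → SWins Cs (wd φ + wd ψ) 𝔸 𝔹
    ⊻-wins {𝔸} c∈ (A⊨ , B⊭) =
      ⊻Move c∈ _ _ (wd>0 φ) (wd>0 ψ) refl (𝔸 ∩ Sat φ) (𝔸 ∩ Sat ψ) proj₁ proj₁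
        (λ a → Sum.map (a ,_) (a ,_) (A⊨ _ a))
        (φ-wins ((λ _ → proj₂) , λ B b → B⊭ B b ∘ inj₁))
        (ψ-wins ((λ _ → proj₂) , λ B b → B⊭ B b ∘ inj₂))

    ∧-wins : T (Cs c∧) → Separates (bin c∧ φ ψ) 𝔸 𝔹 → SWins Cs (wd φ + wd ψ) 𝔸 𝔹
    ∧-wins {𝔹 = 𝔹} c∈ (A⊨ , B⊭) =
      ∧Move c∈ _ _ (wd>0 φ) (wd>0 ψ) refl (𝔹 ∩ ∁ (Sat φ)) (𝔹 ∩ Sat φ) proj₁ proj₁
        (λ {B} b → Sum.swap (Sum.map (b ,_) (b ,_) (toSum (B ⊨? φ))))
        (φ-wins ((λ A → proj₁ ∘ A⊨ A) , λ _ → proj₂))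
        (ψ-wins ((λ A → proj₂ ∘ A⊨ A) , λ B (b , B⊨φ) B⊨ψ → B⊭ B b (B⊨φ , B⊨ψ)))

    ∨-wins : ∀ strict → T (Cs (orConn strict)) → Separates (bin (orConn strict) φ ψ) 𝔸 𝔹 →
      SWins Cs (wd φ + wd ψ) 𝔸 𝔹
    ∨-wins {𝔸} {𝔹} strict c∈ (A⊨ , B⊭) =
      ∨Move strict c∈ _ _ (wd>0 φ) (wd>0 ψ) refl choose f
        (φ-wins ((λ { _ (A , a , refl) → proj₁ (chosen⊨ A a) }) ,
                 λ { _ (B , b , sp , f≡₁ , refl) → side≡₁ (¬? (left sp ⊨? φ)) f≡₁ }))
        (ψ-wins ((λ { _ (A , a , refl) → proj₂ (chosen⊨ A a) }) ,
                 λ { _ (B , b , sp , f≡₂ , refl) R⊨ψ → side≡₂ (¬? (left sp ⊨? φ)) f≡₂ λ L⊨φ →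
                       B⊭ B b (from (⊨orConn⇔ strict) (sp , L⊨φ , R⊨ψ)) }))
      where
      witness? : ∀ X → Dec (SomeSplit strict X φ ψ)
      witness? X = search-Split λ sp → left sp ⊨? φ ×-dec right sp ⊨? ψ
      choose : (X : Team n) → Split strict X
      choose X = choice (trivialSplit strict X) (witness? X)
      chosen⊨ : ∀ A → 𝔸 A → left (choose A) ⊨ φ × right (choose A) ⊨ ψ
      chosen⊨ A a = choice-sat (witness? A) (to (⊨orConn⇔ strict) (A⊨ A a))
      f : (X : Team n) → Split strict X → Side
      f X sp = side (¬? (left sp ⊨? φ))

    ⊼-wins : ∀ strict → T (Cs (barConn strict)) → Separates (bin (barConn strict) φ ψ) 𝔸 𝔹 →
      SWins Cs (wd φ + wd ψ) 𝔸 𝔹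
    ⊼-wins {𝔸} {𝔹} strict c∈ (A⊨ , B⊭) =
      ⊼Move strict c∈ _ _ (wd>0 φ) (wd>0 ψ) refl choose f
        (φ-wins ((λ { _ (A , a , sp , f≡₁ , refl) → side≡₁ (left sp ⊨? φ) f≡₁ }) ,
                 λ { _ (B , b , refl) → chosen⊭ B b ∘ inj₁ }))
        (ψ-wins ((λ { _ (A , a , sp , f≡₂ , refl) →
                       [ ⊥-elim ∘ side≡₂ (left sp ⊨? φ) f≡₂ , id ]
                         (to (⊨barConn⇔ strict) (A⊨ A a) sp) }) ,
                 λ { _ (B , b , refl) → chosen⊭ B b ∘ inj₂ }))
      where
      counterexample? : ∀ X → Dec (Σ (Split strict X) λ sp → ¬ (left sp ⊨ φ ⊎ right sp ⊨ ψ))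
      counterexample? X = search-Split λ sp → ¬? (left sp ⊨? φ ⊎-dec right sp ⊨? ψ)
      choose : (X : Team n) → Split strict X
      choose X = choice (trivialSplit strict X) (counterexample? X)
      chosen⊭ : ∀ B → 𝔹 B → ¬ (left (choose B) ⊨ φ ⊎ right (choose B) ⊨ ψ)
      chosen⊭ B b = choice-sat (counterexample? B)
        (¬∀⇒∃¬ search-Split (λ sp → left sp ⊨? φ ⊎-dec right sp ⊨? ψ)
          (B⊭ B b ∘ from (⊨barConn⇔ strict)))
      f : (X : Team n) → Split strict X → Side
      f X sp = side (left sp ⊨? φ)

  separates⇒wins : (φ : Formula n) → InPL Cs φ → Separates φ 𝔸 𝔹 → SWins Cs (wd φ) 𝔸 𝔹
  separates⇒wins (lit ℓ) _ = litMove ℓ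
  separates⇒wins {Cs = Cs} (bin c φ ψ) (c∈ , φ∈ , ψ∈) = bin-wins c c∈
    where
    φ-wins : ∀ {𝔸 𝔹} → Separates φ 𝔸 𝔹 → SWins Cs (wd φ) 𝔸 𝔹
    φ-wins = separates⇒wins φ φ∈
    ψ-wins : ∀ {𝔸 𝔹} → Separates ψ 𝔸 𝔹 → SWins Cs (wd ψ) 𝔸 𝔹
    ψ-wins = separates⇒wins ψ ψ∈
    open BinaryWins φ ψ φ-wins ψ-wins
    bin-wins : ∀ c → T (Cs c) → Separates (bin c φ ψ) 𝔸 𝔹 → SWins Cs (wd φ + wd ψ) 𝔸 𝔹
    bin-wins c⊻ = ⊻-wins
    bin-wins c∧ = ∧-wins
    bin-wins c∨ = ∨-wins false
    bin-wins c∨̇ = ∨-wins true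
    bin-wins c⊼ = ⊼-wins false
    bin-wins c⊼̇ = ⊼-wins true

theorem3p2 : ∀ {n} (Cs : Connectives) (𝔸₀ 𝔹₀ : TeamSet n) (k₀ : ℕ) →
    SWins Cs k₀ 𝔸₀ 𝔹₀ ⇔ Σ (Formula n) (λ φ → InPL Cs φ × wd φ ≤ k₀ × Separates φ 𝔸₀ 𝔹₀)
theorem3p2 Cs 𝔸₀ 𝔹₀ k₀ =
  mk⇔ wins⇒separable λ (φ , φ∈ , wdφ≤k₀ , sep) → SWins-mono wdφ≤k₀ (separates⇒wins φ φ∈ sep)
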